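{- Let $\mathcal{G}$ be a graph class containing all empty (edgeless) graphs and let $k\ge 0$ be an integer. Then $R_{k}^{\mathcal{G}}(k+2,j)=j$ for all integers $j\geq k+2$.
   Context: All graphs are finite and simple. For a graph $G$ and an integer $k\ge 0$, a $k$-sparse $j$-set is a set of exactly $j$ vertices of $G$ inducing a subgraph of maximum degree at most $k$. A $k$-dense $i$-set is a set of exactly $i$ vertices that is $k$-sparse in the complement of $G$ (i.e. each of its vertices is non-adjacent to at most $k$ other vertices of the set). For a graph class $\mathcal{G}$, the $k$-defective Ramsey number $R_k^{\mathcal{G}}(i,j)$ is the smallest natural number $n$ such that every graph on $n$ vertices belonging to $\mathcal{G}$ has a $k$-dense $i$-set or a $k$-sparse $j$-set. -}

module Defs where

open import Data.Nat using (ℕ; _≤_; _<_)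
open import Data.Bool using (Bool; true; false; not)
open import Data.Fin using (Fin; _≟_)
open import Data.Fin.Subset using (Subset; _∈_; _∩_; ∣_∣)
open import Data.Vec using (tabulate)
open import Data.Product using (_×_)
open import Data.Sum using (_⊎_)
open import Relation.Nullary using (¬_; does)
open import Relation.Binary.PropositionalEquality using (_≡_)

record Graph (n : ℕ) : Set where
  field
    adj   : Fin n → Fin n → Bool
    adj-sym : ∀ u v → adj u v ≡ adj v u
    adj-irrefl : ∀ v → adj v v ≡ false
open Graph public

GraphClass : Set₁
GraphClass = ∀ {n} → Graph n → Set

emptyGraph : (n : ℕ) → Graph n
emptyGraph n = record { adj = λ _ _ → false ; adj-sym = λ _ _ → Relation.Binary.PropositionalEquality.refl ; adj-irrefl = λ _ → Relation.Binary.PropositionalEquality.refl }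

complement : ∀ {n} → Graph n → Graph n
complement {n} G = record { adj = cadj ; adj-sym = csym ; adj-irrefl = cirr }
  where
  open Relation.Binary.PropositionalEquality
  cadj : Fin n → Fin n → Bool
  cadj u v with u ≟ v
  ... | Relation.Nullary.yes _ = false
  ... | Relation.Nullary.no _  = not (adj G u v)
  csym : ∀ u v → cadj u v ≡ cadj v u
  csym u v with u ≟ v | v ≟ u
  ... | Relation.Nullary.yes _ | Relation.Nullary.yes _ = refl
  ... | Relation.Nullary.yes p | Relation.Nullary.no q = Data.Empty.⊥-elim (q (sym p))
    where import Data.Empty
  ... | Relation.Nullary.no p | Relation.Nullary.yes q = Data.Empty.⊥-elim (p (sym q))
    where import Data.Empty
  ... | Relation.Nullary.no _ | Relation.Nullary.no _ = cong not (adj-sym G u v)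
  cirr : ∀ v → cadj v v ≡ false
  cirr v with v ≟ v
  ... | Relation.Nullary.yes _ = refl
  ... | Relation.Nullary.no p = Data.Empty.⊥-elim (p refl)
    where import Data.Empty

nbhd : ∀ {n} → Graph n → Fin n → Subset n
nbhd G v = tabulate (adj G v)

MaxDegInducedAtMost : ∀ {n} → Graph n → ℕ → Subset n → Set
MaxDegInducedAtMost G k S = ∀ v → v ∈ S → ∣ S ∩ nbhd G v ∣ ≤ k

IsSparseSet : ∀ {n} → Graph n → ℕ → ℕ → Subset n → Set
IsSparseSet G k j S = (∣ S ∣ ≡ j) × MaxDegInducedAtMost G k S

IsDenseSet : ∀ {n} → Graph n → ℕ → ℕ → Subset n → Set
IsDenseSet G k i S = IsSparseSet (complement G) k i S

open import Data.Product using (∃)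

RamseyProperty : GraphClass → ℕ → ℕ → ℕ → ℕ → Set
RamseyProperty 𝒢 k i j n =
  (G : Graph n) → 𝒢 G → (∃ λ S → IsDenseSet G k i S) ⊎ (∃ λ S → IsSparseSet G k j S)

IsDefectiveRamseyNumber : GraphClass → ℕ → ℕ → ℕ → ℕ → Set
IsDefectiveRamseyNumber 𝒢 k i j r =
  RamseyProperty 𝒢 k i j r × (∀ m → m < r → ¬ RamseyProperty 𝒢 k i j m)

ContainsEmptyGraphs : GraphClass → Set
ContainsEmptyGraphs 𝒢 = ∀ n → 𝒢 (emptyGraph n)

-- If a graph on j vertices has maximum degree at most k, its whole vertex set
-- is a k-sparse j-set. Otherwise some vertex v has k + 1 neighbours, and v
-- with k + 1 of them is a k-dense (k + 2)-set: each neighbour u is adjacent to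
-- v, so it misses at most the k vertices other than u and v. On fewer than j
-- vertices the edgeless graph has neither set: there is no room for j
-- vertices, and every vertex of a (k + 2)-set misses the other k + 1.
module Submission where

open import Defs
open import Data.Nat using (ℕ; suc; _+_; _≤_; _<_; _≥_; _≤?_; z≤n; s≤s; s≤s⁻¹)
open import Data.Nat.Properties
  using (≤-trans; n≤1+n; 1+n≰n; ≤-reflexive; +-comm; +-cancelˡ-≤; ≰⇒>; <⇒≱; module ≤-Reasoning)
open import Data.Bool using (true; false; not)
open import Data.Fin using (Fin; zero; suc; _≟_)
open import Data.Fin.Properties using (all?; ¬∀⟶∃¬)
open import Data.Fin.Subset
open import Data.Fin.Subset.Properties
open import Data.Vec using (_∷_; here; there)
open import Data.Vec.Properties using (lookup∘tabulate; []=⇒lookup; lookup⇒[]=)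
open import Data.Product using (_×_; _,_; ∃; proj₂)
open import Data.Sum using (_⊎_; inj₁; inj₂)
open import Function using (_∘_; case_of_)
open import Relation.Nullary using (¬_; yes; no; contradiction)
open import Relation.Binary.PropositionalEquality
  using (_≡_; _≢_; refl; sym; trans; cong; subst)

Empty⇒∣p∣≡0 : ∀ {n} {p : Subset n} → Empty p → ∣ p ∣ ≡ 0
Empty⇒∣p∣≡0 {n} p≡∅ = trans (cong ∣_∣ (Empty-unique p≡∅)) (∣⊥∣≡0 n)

∣p∣≡1+m⇒Nonempty : ∀ {n m} (p : Subset n) → ∣ p ∣ ≡ suc m → Nonempty p
∣p∣≡1+m⇒Nonempty p ∣p∣≡1+m with nonempty? p
... | yes p≢∅ = p≢∅
... | no p≡∅ with trans (sym ∣p∣≡1+m) (Empty⇒∣p∣≡0 p≡∅)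
...   | ()

x∉p-x : ∀ {n} (p : Subset n) (x : Fin n) → x ∉ p - x
x∉p-x (_ ∷ p) zero    ()
x∉p-x (_ ∷ p) (suc x) (there x∈p-x) = x∉p-x p x x∈p-x

∣p∣≤1+∣p-x∣ : ∀ {n} (p : Subset n) (x : Fin n) → ∣ p ∣ ≤ suc ∣ p - x ∣
∣p∣≤1+∣p-x∣ (outside ∷ p) zero    = ≤-trans (≤-reflexive (sym (cong ∣_∣ (p─⊥≡p p)))) (n≤1+n _)
∣p∣≤1+∣p-x∣ (inside  ∷ p) zero    = s≤s (≤-reflexive (sym (cong ∣_∣ (p─⊥≡p p))))
∣p∣≤1+∣p-x∣ (outside ∷ p) (suc x) = ∣p∣≤1+∣p-x∣ p x
∣p∣≤1+∣p-x∣ (inside  ∷ p) (suc x) = s≤s (∣p∣≤1+∣p-x∣ p x)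

x∈q∧p⊂q-x⇒2+∣p∣≤∣q∣ : ∀ {n} {p q : Subset n} {x : Fin n} → x ∈ q → p ⊂ q - x → 2 + ∣ p ∣ ≤ ∣ q ∣
x∈q∧p⊂q-x⇒2+∣p∣≤∣q∣ x∈q p⊂q-x = ≤-trans (s≤s (p⊂q⇒∣p∣<∣q∣ p⊂q-x)) (x∈p⇒∣p-x∣<∣p∣ x∈q)

x∉p⇒∣⁅x⁆∪p∣≡1+∣p∣ : ∀ {n} (x : Fin n) (p : Subset n) → x ∉ p → ∣ ⁅ x ⁆ ∪ p ∣ ≡ suc ∣ p ∣
x∉p⇒∣⁅x⁆∪p∣≡1+∣p∣ zero    (inside  ∷ p) x∉p = contradiction here x∉p
x∉p⇒∣⁅x⁆∪p∣≡1+∣p∣ zero    (outside ∷ p) x∉p = cong (λ q → suc ∣ q ∣) (∪-identityˡ p)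
x∉p⇒∣⁅x⁆∪p∣≡1+∣p∣ (suc x) (inside  ∷ p) x∉p = cong suc (x∉p⇒∣⁅x⁆∪p∣≡1+∣p∣ x p (x∉p ∘ there))
x∉p⇒∣⁅x⁆∪p∣≡1+∣p∣ (suc x) (outside ∷ p) x∉p = x∉p⇒∣⁅x⁆∪p∣≡1+∣p∣ x p (x∉p ∘ there)

∃⊆-ofSize : ∀ {n} (p : Subset n) r → r ≤ ∣ p ∣ → ∃ λ q → q ⊆ p × ∣ q ∣ ≡ r
∃⊆-ofSize {n} p 0 _ = ⊥ , (λ x∈⊥ → contradiction x∈⊥ ∉⊥) , ∣⊥∣≡0 n
∃⊆-ofSize (outside ∷ p) r r≤∣p∣ with ∃⊆-ofSize p r r≤∣p∣
... | q , q⊆p , ∣q∣≡r = outside ∷ q , (λ { (there x∈q) → there (q⊆p x∈q) }) , ∣q∣≡r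
∃⊆-ofSize (inside ∷ p) (suc r) r≤∣p∣ with ∃⊆-ofSize p r (s≤s⁻¹ r≤∣p∣)
... | q , q⊆p , ∣q∣≡r = inside ∷ q , (λ { here → here ; (there x∈q) → there (q⊆p x∈q) }) , cong suc ∣q∣≡r

∈-nbhd⁻ : ∀ {n} (G : Graph n) {v u} → u ∈ nbhd G v → adj G v u ≡ true
∈-nbhd⁻ G {v} {u} u∈N = trans (sym (lookup∘tabulate (adj G v) u)) ([]=⇒lookup u∈N)

∈-nbhd⁺ : ∀ {n} (G : Graph n) {v u} → adj G v u ≡ true → u ∈ nbhd G v
∈-nbhd⁺ G {v} {u} vu = lookup⇒[]= u _ (trans (lookup∘tabulate (adj G v) u) vu)

∉-nbhd-self : ∀ {n} (G : Graph n) v → v ∉ nbhd G v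
∉-nbhd-self G v v∈N with trans (sym (adj-irrefl G v)) (∈-nbhd⁻ G v∈N)
... | ()

∈-nbhd-sym : ∀ {n} (G : Graph n) {u v} → u ∈ nbhd G v → v ∈ nbhd G u
∈-nbhd-sym G {u} {v} u∈N = ∈-nbhd⁺ G (trans (adj-sym G u v) (∈-nbhd⁻ G u∈N))

∈-complement-nbhd⇒∉-nbhd : ∀ {n} (G : Graph n) {u v} → u ∈ nbhd (complement G) v → u ∉ nbhd G v
∈-complement-nbhd⇒∉-nbhd G {u} {v} u∈Nᶜ u∈N with v ≟ u | ∈-nbhd⁻ (complement G) {v} {u} u∈Nᶜ
... | yes _ | ()
... | no _  | ¬vu with subst (λ b → not b ≡ true) (∈-nbhd⁻ G {v} {u} u∈N) ¬vu
...   | ()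

∉-nbhd⇒∈-complement-nbhd : ∀ {n} (G : Graph n) {u v} → u ≢ v → u ∉ nbhd G v → u ∈ nbhd (complement G) v
∉-nbhd⇒∈-complement-nbhd G {u} {v} u≢v u∉N = ∈-nbhd⁺ (complement G) {v} {u} complement-adj
  where
  complement-adj : adj (complement G) v u ≡ true
  complement-adj with v ≟ u
  ... | yes v≡u = contradiction (sym v≡u) u≢v
  ... | no _ with adj G v u in vu
  ...   | false = refl
  ...   | true  = contradiction (∈-nbhd⁺ G vu) u∉N

≢⇒∈-nbhd-complement-emptyGraph : ∀ {n} {u v : Fin n} → u ≢ v → u ∈ nbhd (complement (emptyGraph n)) v
≢⇒∈-nbhd-complement-emptyGraph {n} {u} {v} u≢v =
  ∉-nbhd⇒∈-complement-nbhd (emptyGraph n) {v = v} u≢v λ u∈N → case ∈-nbhd⁻ (emptyGraph n) {v} u∈N of λ ()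

maxDeg≤⊎∃deg> : ∀ {n} (G : Graph n) k → MaxDegInducedAtMost G k ⊤ ⊎ ∃ λ v → k < ∣ nbhd G v ∣
maxDeg≤⊎∃deg> {n} G k with all? (λ v → ∣ ⊤ ∩ nbhd G v ∣ ≤? k)
... | yes deg≤k = inj₁ (λ v _ → deg≤k v)
... | no ¬deg≤k with ¬∀⟶∃¬ n _ (λ v → ∣ ⊤ ∩ nbhd G v ∣ ≤? k) ¬deg≤k
...   | v , deg≰k = inj₂ (v , ≤-trans (≰⇒> deg≰k) (∣p∩q∣≤∣q∣ ⊤ (nbhd G v)))

star-isDenseSet : ∀ {n} (G : Graph n) k {v T} → T ⊆ nbhd G v → ∣ T ∣ ≡ suc k →
  IsDenseSet G k (k + 2) (⁅ v ⁆ ∪ T)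
star-isDenseSet G k {v} {T} T⊆N ∣T∣≡1+k = trans ∣S∣≡2+k (+-comm 2 k) , bounded
  where
  S = ⁅ v ⁆ ∪ T
  Nᶜ = nbhd (complement G)

  ∣S∣≡2+k : ∣ S ∣ ≡ 2 + k
  ∣S∣≡2+k = trans (x∉p⇒∣⁅x⁆∪p∣≡1+∣p∣ v T (∉-nbhd-self G v ∘ T⊆N)) (cong suc ∣T∣≡1+k)

  centre-isolated : Empty (S ∩ Nᶜ v)
  centre-isolated (w , w∈S∩Nᶜ) with x∈p∩q⁻ S (Nᶜ v) w∈S∩Nᶜ
  ... | w∈S , w∈Nᶜ with x∈p∪q⁻ ⁅ v ⁆ T w∈S
  ...   | inj₁ w∈⁅v⁆ = ∉-nbhd-self (complement G) v (subst (_∈ Nᶜ v) (x∈⁅y⁆⇒x≡y v w∈⁅v⁆) w∈Nᶜ)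
  ...   | inj₂ w∈T  = ∈-complement-nbhd⇒∉-nbhd G w∈Nᶜ (T⊆N w∈T)

  leaf-nonNbhd⊂S-v : ∀ {u} → u ∈ T → S ∩ Nᶜ u ⊂ S - v
  leaf-nonNbhd⊂S-v {u} u∈T = ⊆S-v , u , x∈p∧x≢y⇒x∈p-y (x∈p∪q⁺ (inj₂ u∈T)) u≢v , u∉Nᶜu
    where
    u≢v : u ≢ v
    u≢v refl = ∉-nbhd-self G u (T⊆N u∈T)
    u∉Nᶜu : u ∉ S ∩ Nᶜ u
    u∉Nᶜu u∈ = ∉-nbhd-self (complement G) u (proj₂ (x∈p∩q⁻ S (Nᶜ u) u∈))
    ⊆S-v : S ∩ Nᶜ u ⊆ S - v
    ⊆S-v {w} w∈ with x∈p∩q⁻ S (Nᶜ u) w∈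
    ... | w∈S , w∈Nᶜ = x∈p∧x≢y⇒x∈p-y w∈S λ { refl →
          ∈-complement-nbhd⇒∉-nbhd G w∈Nᶜ (∈-nbhd-sym G (T⊆N u∈T)) }

  bounded : MaxDegInducedAtMost (complement G) k S
  bounded u u∈S with x∈p∪q⁻ ⁅ v ⁆ T u∈S
  ... | inj₁ u∈⁅v⁆ rewrite x∈⁅y⁆⇒x≡y v u∈⁅v⁆ =
    subst (_≤ k) (sym (Empty⇒∣p∣≡0 centre-isolated)) z≤n
  ... | inj₂ u∈T = +-cancelˡ-≤ 2 _ _ (begin
    2 + ∣ S ∩ Nᶜ u ∣  ≤⟨ x∈q∧p⊂q-x⇒2+∣p∣≤∣q∣ (x∈p∪q⁺ (inj₁ (x∈⁅x⁆ v))) (leaf-nonNbhd⊂S-v u∈T) ⟩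
    ∣ S ∣             ≡⟨ ∣S∣≡2+k ⟩
    2 + k             ∎)
    where open ≤-Reasoning

denseSet⊎spanningSparseSet : ∀ {n} (G : Graph n) k →
  (∃ λ S → IsDenseSet G k (k + 2) S) ⊎ (∃ λ S → IsSparseSet G k n S)
denseSet⊎spanningSparseSet {n} G k with maxDeg≤⊎∃deg> G k
... | inj₁ maxDeg≤k = inj₂ (⊤ , ∣⊤∣≡n n , maxDeg≤k)
... | inj₂ (v , k<deg) with ∃⊆-ofSize (nbhd G v) (suc k) k<deg
...   | T , T⊆N , ∣T∣≡1+k = inj₁ (⁅ v ⁆ ∪ T , star-isDenseSet G k T⊆N ∣T∣≡1+k)

emptyGraph-noDenseSet : ∀ {n} k S → ¬ IsDenseSet (emptyGraph n) k (k + 2) S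
emptyGraph-noDenseSet {n} k S (∣S∣≡k+2 , bounded) with ∣p∣≡1+m⇒Nonempty S (trans ∣S∣≡k+2 (+-comm k 2))
... | v , v∈S = 1+n≰n (begin
  suc (suc k)             ≡⟨ trans ∣S∣≡k+2 (+-comm k 2) ⟨
  ∣ S ∣                   ≤⟨ ∣p∣≤1+∣p-x∣ S v ⟩
  suc ∣ S - v ∣           ≤⟨ s≤s (p⊆q⇒∣p∣≤∣q∣ S-v⊆S∩Nᶜ) ⟩
  suc ∣ S ∩ Nᶜ v ∣        ≤⟨ s≤s (bounded v v∈S) ⟩
  suc k                   ∎)
  where
  open ≤-Reasoning
  Nᶜ = nbhd (complement (emptyGraph n))
  S-v⊆S∩Nᶜ : S - v ⊆ S ∩ Nᶜ v
  S-v⊆S∩Nᶜ {w} w∈S-v =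
    x∈p∩q⁺ (p─q⊆p S ⁅ v ⁆ w∈S-v , ≢⇒∈-nbhd-complement-emptyGraph {v = v} λ { refl → x∉p-x S v w∈S-v })

lemma2p1 : (𝒢 : GraphClass) → ContainsEmptyGraphs 𝒢 → (k j : ℕ) → j ≥ k + 2 →
    IsDefectiveRamseyNumber 𝒢 k (k + 2) j j
lemma2p1 𝒢 hE k j _ = (λ G _ → denseSet⊎spanningSparseSet G k) , noRamsey
  where
  noRamsey : ∀ m → m < j → ¬ RamseyProperty 𝒢 k (k + 2) j m
  noRamsey m m<j ramsey with ramsey (emptyGraph m) (hE m)
  ... | inj₁ (S , dense) = emptyGraph-noDenseSet k S dense
  ... | inj₂ (S , ∣S∣≡j , _) = <⇒≱ m<j (subst (_≤ m) ∣S∣≡j (∣p∣≤n S))
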